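{- Let $D$ be a tournament and $T\subseteq V(D)$. Suppose an arc $e$ is contained in some minimum $T$-feedback arc set of $D$, and let $D'$ be the tournament obtained from $D$ by reversing $e$. Then for every arc set $S\subseteq A(D)$ with $e\in S$, $S$ is a minimum $T$-feedback arc set of $D$ if and only if $S\setminus\{e\}$ is a minimum $T$-feedback arc set of $D'$.
   Context: A $T$-cycle is a directed cycle containing a vertex of $T$; a $T$-feedback arc set of $D$ is an arc set $S$ such that $D-S$ has no $T$-cycle; it is minimum if it has minimum size among all $T$-feedback arc sets of $D$. Arcs of $D$ other than $e$ are also arcs of $D'$, so $S\setminus\{e\}\subseteq A(D')$. -}

module Defs where

open import Data.Nat using (ℕ; _+_; _≤_)
open import Data.Bool using (Bool; true; false; not; _∧_; if_then_else_)
open import Data.Fin using (Fin; _≟_)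
open import Data.Fin.Subset using (Subset; _∈_)
open import Data.List using (List; []; _∷_; map)
open import Data.Nat.ListAction using (sum)
open import Data.List.Relation.Unary.Any using (Any)
open import Data.List.Relation.Unary.Unique.Propositional using (Unique)
open import Data.Product using (_×_)
open import Data.Empty using (⊥)
open import Relation.Nullary using (¬_)
open import Relation.Nullary.Decidable using (⌊_⌋)
open import Relation.Binary.PropositionalEquality using (_≡_; _≢_)
open import Data.List using (allFin)

-- A digraph / arc set on vertex set Fin n, as a Boolean adjacency relation:
-- R i j ≡ true  iff  (i , j) is an arc.
Rel : ℕ → Set
Rel n = Fin n → Fin n → Bool

IsTournament : ∀ {n} → Rel n → Set
IsTournament {n} D =
  ((i : Fin n) → D i i ≡ false) ×
  ((i j : Fin n) → i ≢ j → D j i ≡ not (D i j))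

_⊆A_ : ∀ {n} → Rel n → Rel n → Set
_⊆A_ {n} S D = (i j : Fin n) → S i j ≡ true → D i j ≡ true

size : ∀ {n} → Rel n → ℕ
size {n} S = sum (map (λ i → sum (map (λ j → if S i j then 1 else 0) (allFin n))) (allFin n))

_－_ : ∀ {n} → Rel n → Rel n → Rel n
(D － S) i j = D i j ∧ not (S i j)

Chain : ∀ {n} → Rel n → Fin n → List (Fin n) → Fin n → Set
Chain R x [] y = R x y ≡ true
Chain R x (z ∷ zs) y = (R x z ≡ true) × Chain R z zs y

IsCycle : ∀ {n} → Rel n → Fin n → List (Fin n) → Set
IsCycle R v vs = Unique (v ∷ vs) × Chain R v vs v

IsTCycle : ∀ {n} → Rel n → Subset n → Fin n → List (Fin n) → Set
IsTCycle R T v vs = IsCycle R v vs × Any (_∈ T) (v ∷ vs)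

HasNoTCycle : ∀ {n} → Rel n → Subset n → Set
HasNoTCycle {n} R T = (v : Fin n) (vs : List (Fin n)) → ¬ IsTCycle R T v vs

IsTFAS : ∀ {n} → Rel n → Subset n → Rel n → Set
IsTFAS D T S = (S ⊆A D) × HasNoTCycle (D － S) T

IsMinTFAS : ∀ {n} → Rel n → Subset n → Rel n → Set
IsMinTFAS {n} D T S = IsTFAS D T S × ((S' : Rel n) → IsTFAS D T S' → size S ≤ size S')

isPair : ∀ {n} → Fin n → Fin n → Fin n → Fin n → Bool
isPair u v i j = ⌊ i ≟ u ⌋ ∧ ⌊ j ≟ v ⌋

reverseArc : ∀ {n} → Rel n → Fin n → Fin n → Rel n
reverseArc D u v i j =
  if isPair v u i j then true else (if isPair u v i j then false else D i j)

removeArc : ∀ {n} → Rel n → Fin n → Fin n → Rel n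
removeArc S u v i j = S i j ∧ not (isPair u v i j)

-- Write F = D − S and S⁻ = S ∖ {uv}. Then D − S⁻ ⊆ F + uv and D′ − S⁻ ⊆ F + vu. If F has no
-- T-cycle, F + uv and F + vu cannot both have one: paths u ⇝ t ⇝ v and v ⇝ t′ ⇝ u in F
-- would close up into a T-cycle of F. Minimality of S forces a T-cycle in F + uv, so S⁻ is a
-- T-feedback arc set of D′. Reversing vu back turns any T-feedback arc set R of D′ into one of
-- D of size at most |R| + 1, which gives minimality of S⁻; conversely D − S ⊆ D′ − S⁻, and the
-- given minimum set S₀ ∋ uv pins the minimum size of D′ at |S₀| − 1.
module Submission where

open import Defs
open import Algebra.Properties.CommutativeSemigroup using (interchange)
open import Data.Bool using (Bool; true; false; not; _∨_; if_then_else_)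
open import Data.Bool.Properties using (∧-conicalˡ)
open import Data.Empty using (⊥-elim)
open import Data.Fin using (Fin; _≟_)
open import Data.Fin.Subset using (Subset)
import Data.Fin.Subset as Subset
open import Data.List using (List; []; _∷_; map; allFin)
open import Data.List.Membership.Propositional using () renaming (_∈_ to _∈ˡ_; _∉_ to _∉ˡ_)
open import Data.List.Membership.Propositional.Properties using (∈-allFin)
import Data.List.Membership.DecPropositional as DecMembership
open import Data.List.Properties using (map-cong)
open import Data.List.Relation.Unary.All using ([]; _∷_)
open import Data.List.Relation.Unary.All.Properties using (¬Any⇒All¬; All¬⇒¬Any)
open import Data.List.Relation.Unary.Any using (Any; here; there)
open import Data.List.Relation.Unary.AllPairs using ([]; _∷_)
open import Data.List.Relation.Unary.Unique.Propositional using (Unique)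
open import Data.List.Relation.Unary.Unique.Propositional.Properties using (allFin⁺)
open import Data.Nat using (ℕ; suc; _+_; _≤_; z≤n; s≤s)
open import Data.Nat.ListAction using (sum)
open import Data.Nat.Properties
  using (≤-refl; ≤-trans; ≤-reflexive; ≤-pred; 1+n≰n; +-mono-≤; +-commutativeSemigroup; module ≤-Reasoning)
open import Data.Product using (_×_; ∃; Σ; _,_; proj₁; proj₂)
open import Data.Sum using (_⊎_; inj₁; inj₂)
open import Function.Bundles using (_⇔_; mk⇔)
open import Relation.Nullary using (¬_; yes; no)
open import Relation.Nullary.Decidable using (⌊_⌋)
open import Relation.Binary.PropositionalEquality
  using (_≡_; _≢_; refl; sym; trans; cong; subst; module ≡-Reasoning)

ind : Bool → ℕ
ind b = if b then 1 else 0

true≢false : true ≢ false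
true≢false ()

module _ {A : Set} where

  sum-map-mono : ∀ {f g : A → ℕ} → (∀ x → f x ≤ g x) → ∀ xs → sum (map f xs) ≤ sum (map g xs)
  sum-map-mono f≤g [] = z≤n
  sum-map-mono f≤g (x ∷ xs) = +-mono-≤ (f≤g x) (sum-map-mono f≤g xs)

  sum-map-+ : ∀ (f g : A → ℕ) xs → sum (map (λ x → f x + g x) xs) ≡ sum (map f xs) + sum (map g xs)
  sum-map-+ f g [] = refl
  sum-map-+ f g (x ∷ xs) = begin
    f x + g x + sum (map (λ x → f x + g x) xs)    ≡⟨ cong (f x + g x +_) (sum-map-+ f g xs) ⟩
    f x + g x + (sum (map f xs) + sum (map g xs)) ≡⟨ interchange +-commutativeSemigroup (f x) (g x) _ _ ⟩
    f x + sum (map f xs) + (g x + sum (map g xs)) ∎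
    where open ≡-Reasoning

  sum-map-zero : ∀ xs → sum (map (λ (_ : A) → 0) xs) ≡ 0
  sum-map-zero [] = refl
  sum-map-zero (_ ∷ xs) = sum-map-zero xs

module _ {n : ℕ} where

  open DecMembership (_≟_ {n}) using () renaming (_∈?_ to _∈ˡ?_)

  data Walk (R : Rel n) : Fin n → Fin n → Set where
    [_] : (x : Fin n) → Walk R x x
    _∷_ : ∀ {x y z} → R x y ≡ true → Walk R y z → Walk R x z

  infixr 5 _∷_ _++ʷ_

  departures : ∀ {R x z} → Walk R x z → List (Fin n)
  departures [ _ ] = []
  departures (_∷_ {x} _ w) = x ∷ departures w

  _++ʷ_ : ∀ {R x y z} → Walk R x y → Walk R y z → Walk R x z
  [ _ ] ++ʷ w = w
  (a ∷ p) ++ʷ w = a ∷ (p ++ʷ w)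

  chain⇒walk : ∀ {R} x zs y → Chain R x zs y → Σ (Walk R x y) λ w → departures w ≡ x ∷ zs
  chain⇒walk x [] y a = a ∷ [ y ] , refl
  chain⇒walk x (z ∷ zs) y (a , ch) with chain⇒walk z zs y ch
  ... | w , deps = a ∷ w , cong (x ∷_) deps

  walk⇒chain : ∀ {R x y z} → R x y ≡ true → (w : Walk R y z) → Chain R x (departures w) z
  walk⇒chain a [ _ ] = a
  walk⇒chain a (b ∷ w) = a , walk⇒chain b w

  IsPath : ∀ {R x z} → Walk R x z → Set
  IsPath {z = z} w = Unique (z ∷ departures w)

  suffixPath : ∀ {R x y z} (p : Walk R y z) → x ∈ˡ departures p →
               Σ (Walk R x z) λ q → IsPath p → IsPath q
  suffixPath (a ∷ p) (here refl) = a ∷ p , λ path → path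
  suffixPath (a ∷ p) (there x∈p) with suffixPath p x∈p
  ... | q , path⇒path = q , λ { ((_ ∷ z∉) ∷ (_ ∷ uniq)) → path⇒path (z∉ ∷ uniq) }

  walk⇒path : ∀ {R x z} → Walk R x z → Σ (Walk R x z) IsPath
  walk⇒path [ z ] = [ z ] , [] ∷ []
  walk⇒path {x = x} {z} (a ∷ w) with walk⇒path w
  ... | p , path@(z∉p ∷ uniq) with x ∈ˡ? departures p
  ...   | yes x∈p = let (q , path⇒path) = suffixPath p x∈p in q , path⇒path path
  ...   | no x∉p with x ≟ z
  ...     | yes refl = [ x ] , [] ∷ []
  ...     | no x≢z = a ∷ p , (((λ z≡x → x≢z (sym z≡x)) ∷ z∉p) ∷ (¬Any⇒All¬ _ x∉p ∷ uniq))

  TClosedWalk : Rel n → Subset n → Set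
  TClosedWalk R T = ∃ λ t → t Subset.∈ T × ∃ λ y → R t y ≡ true × Walk R y t

  tClosedWalk⇒tCycle : ∀ {R T} → TClosedWalk R T → ¬ HasNoTCycle R T
  tClosedWalk⇒tCycle (t , t∈T , _ , a , w) noCycle with walk⇒path w
  ... | p , path = noCycle t (departures p) ((path , walk⇒chain a p) , here t∈T)

  splitAtDeparture : ∀ {R x z} {P : Fin n → Set} (w : Walk R x z) → Any P (departures w) →
                     ∃ λ t → P t × Walk R x t × ∃ λ y → R t y ≡ true × Walk R y z
  splitAtDeparture {x = x} (a ∷ w) (here Px) = x , Px , [ x ] , _ , a , w
  splitAtDeparture (a ∷ w) (there any) with splitAtDeparture w any
  ... | t , Pt , w₁ , y , b , w₂ = t , Pt , a ∷ w₁ , y , b , w₂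

  tCycle⇒tClosedWalk : ∀ {R T c cs} → IsTCycle R T c cs → TClosedWalk R T
  tCycle⇒tClosedWalk {T = T} {c} {cs} ((_ , ch) , meetsT) with chain⇒walk c cs c ch
  ... | w , deps with splitAtDeparture w (subst (Any (Subset._∈ T)) (sym deps) meetsT)
  ...   | t , t∈T , w₁ , y , a , w₂ = t , t∈T , y , a , w₂ ++ʷ w₁

  Chain-mono : ∀ {R R' : Rel n} → R ⊆A R' → ∀ x zs y → Chain R x zs y → Chain R' x zs y
  Chain-mono R⊆R' x [] y a = R⊆R' x y a
  Chain-mono R⊆R' x (z ∷ zs) y (a , ch) = R⊆R' x z a , Chain-mono R⊆R' z zs y ch

  IsTCycle-mono : ∀ {R R' T v vs} → R ⊆A R' → IsTCycle R T v vs → IsTCycle R' T v vs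
  IsTCycle-mono {v = v} {vs} R⊆R' ((uniq , ch) , meetsT) = (uniq , Chain-mono R⊆R' v vs v ch) , meetsT

  HasNoTCycle-antimono : ∀ {R R' T} → R ⊆A R' → HasNoTCycle R' T → HasNoTCycle R T
  HasNoTCycle-antimono R⊆R' noCycle v vs cycle = noCycle v vs (IsTCycle-mono R⊆R' cycle)

  arc : Fin n → Fin n → Rel n
  arc = isPair

  _∪_ : Rel n → Rel n → Rel n
  (R ∪ R') i j = R i j ∨ R' i j

  ∪-true : ∀ (R R' : Rel n) i j → (R ∪ R') i j ≡ true → R i j ≡ true ⊎ R' i j ≡ true
  ∪-true R R' i j h with R i j
  ... | true = inj₁ refl
  ... | false = inj₂ h

  arc-true : ∀ {p q i j : Fin n} → arc p q i j ≡ true → i ≡ p × j ≡ q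
  arc-true {p} {q} {i} {j} h with i ≟ p | j ≟ q
  ... | yes i≡p | yes j≡q = i≡p , j≡q
  arc-true () | yes _ | no _
  arc-true () | no _ | _

  module _ {F : Rel n} {p q : Fin n} where

    lastLeg : ∀ {z} → Walk F q z ⊎ (Walk F q p × Walk F q z) → Walk F q z
    lastLeg (inj₁ w) = w
    lastLeg (inj₂ (_ , w)) = w

    walk-via-arc : ∀ {x z} → Walk (arc p q ∪ F) x z → Walk F x z ⊎ (Walk F x p × Walk F q z)
    walk-via-arc [ z ] = inj₁ [ z ]
    walk-via-arc {x} (_∷_ {y = y} a w) with ∪-true (arc p q) F x y a | walk-via-arc w
    ... | inj₁ a-is-pq | rest with arc-true {p} {q} {x} {y} a-is-pq
    ...   | refl , refl = inj₂ ([ p ] , lastLeg rest)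
    walk-via-arc (a ∷ w) | inj₂ aF | inj₁ w′ = inj₁ (aF ∷ w′)
    walk-via-arc (a ∷ w) | inj₂ aF | inj₂ (w₁ , w₂) = inj₂ (aF ∷ w₁ , w₂)

    tCycle-via-arc : ∀ {T c cs} → HasNoTCycle F T → IsTCycle (arc p q ∪ F) T c cs →
                     ∃ λ t → t Subset.∈ T × Walk F q t × Walk F t p
    tCycle-via-arc noCycle cycle with tCycle⇒tClosedWalk cycle
    ... | t , t∈T , y , a , w with ∪-true (arc p q) F t y a | walk-via-arc w
    ... | inj₂ aF | inj₁ w′ = ⊥-elim (tClosedWalk⇒tCycle (t , t∈T , y , aF , w′) noCycle)
    ... | inj₂ aF | inj₂ (w₁ , w₂) = t , t∈T , w₂ , aF ∷ w₁
    ... | inj₁ a-is-pq | w′ with arc-true {p} {q} {t} {y} a-is-pq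
    ...   | refl , refl = p , t∈T , lastLeg w′ , [ p ]

  tClosedWalk-from-legs : ∀ {F T t a b} → a ≢ b → t Subset.∈ T →
                        Walk F t b → Walk F b a → Walk F a t → TClosedWalk F T
  tClosedWalk-from-legs a≢b t∈T (e ∷ p) q r = _ , t∈T , _ , e , p ++ʷ q ++ʷ r
  tClosedWalk-from-legs a≢b t∈T [ _ ] (e ∷ q) r = _ , t∈T , _ , e , q ++ʷ r
  tClosedWalk-from-legs a≢b t∈T [ _ ] [ _ ] r = ⊥-elim (a≢b refl)

  -- F + pq and F + qp cannot both have T-cycles: glued together they form one in F.
  tCycle-arc-exclusive : ∀ {F T p q c cs} → p ≢ q → HasNoTCycle F T →
                         IsTCycle (arc p q ∪ F) T c cs → HasNoTCycle (arc q p ∪ F) T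
  tCycle-arc-exclusive p≢q noCycle cycle v vs cycle′
    with tCycle-via-arc noCycle cycle | tCycle-via-arc noCycle cycle′
  ... | t , t∈T , q⇝t , t⇝p | _ , _ , p⇝t′ , t′⇝q =
    tClosedWalk⇒tCycle (tClosedWalk-from-legs (λ q≡p → p≢q (sym q≡p)) t∈T t⇝p (p⇝t′ ++ʷ t′⇝q) q⇝t) noCycle

  count-≟-∉ : ∀ {b : Fin n} xs → b ∉ˡ xs → sum (map (λ j → ind ⌊ j ≟ b ⌋) xs) ≡ 0
  count-≟-∉ [] b∉ = refl
  count-≟-∉ {b} (x ∷ xs) b∉ with x ≟ b
  ... | yes refl = ⊥-elim (b∉ (here refl))
  ... | no _ = count-≟-∉ xs (λ b∈ → b∉ (there b∈))

  count-≟-unique : ∀ {b : Fin n} {xs} → Unique xs → b ∈ˡ xs → sum (map (λ j → ind ⌊ j ≟ b ⌋) xs) ≡ 1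
  count-≟-unique {b} {x ∷ xs} (x∉xs ∷ uniq) b∈ with x ≟ b | b∈
  ... | yes refl | _ = cong suc (count-≟-∉ xs (All¬⇒¬Any x∉xs))
  ... | no x≢b | here b≡x = ⊥-elim (x≢b (sym b≡x))
  ... | no _ | there b∈xs = count-≟-unique uniq b∈xs

  count-≟-allFin : (b : Fin n) → sum (map (λ j → ind ⌊ j ≟ b ⌋) (allFin n)) ≡ 1
  count-≟-allFin b = count-≟-unique (allFin⁺ n) (∈-allFin b)

  -- size R unfolds to sumPairs (λ i j → ind (R i j)).
  sumPairs : (Fin n → Fin n → ℕ) → ℕ
  sumPairs f = sum (map (λ i → sum (map (f i) (allFin n))) (allFin n))

  sumPairs-mono : ∀ {f g} → (∀ i j → f i j ≤ g i j) → sumPairs f ≤ sumPairs g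
  sumPairs-mono f≤g = sum-map-mono (λ i → sum-map-mono (f≤g i) (allFin n)) (allFin n)

  sumPairs-cong : ∀ {f g} → (∀ i j → f i j ≡ g i j) → sumPairs f ≡ sumPairs g
  sumPairs-cong f≡g = cong sum (map-cong (λ i → cong sum (map-cong (f≡g i) (allFin n))) (allFin n))

  sumPairs-+ : ∀ f g → sumPairs (λ i j → f i j + g i j) ≡ sumPairs f + sumPairs g
  sumPairs-+ f g = trans (cong sum (map-cong (λ i → sum-map-+ (f i) (g i) (allFin n)) (allFin n)))
                         (sum-map-+ _ _ (allFin n))

  ind-mono : ∀ {x y} → (x ≡ true → y ≡ true) → ind x ≤ ind y
  ind-mono {false} x⇒y = z≤n
  ind-mono {true} x⇒y rewrite x⇒y refl = ≤-refl

  size-mono : ∀ {R R' : Rel n} → R ⊆A R' → size R ≤ size R'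
  size-mono R⊆R' = sumPairs-mono (λ i j → ind-mono (R⊆R' i j))

  size-∪ : ∀ (R R' : Rel n) → size (R ∪ R') ≤ size R + size R'
  size-∪ R R' = ≤-trans (sumPairs-mono ind-∨) (≤-reflexive (sumPairs-+ _ _))
    where
      ind-∨ : ∀ i j → ind (R i j ∨ R' i j) ≤ ind (R i j) + ind (R' i j)
      ind-∨ i j with R i j | R' i j
      ... | true | _ = s≤s z≤n
      ... | false | _ = ≤-refl

  size-arc : ∀ (p q : Fin n) → size (arc p q) ≡ 1
  size-arc p q = trans (cong sum (map-cong row (allFin n))) (count-≟-allFin p)
    where
      row : ∀ i → sum (map (λ j → ind (arc p q i j)) (allFin n)) ≡ ind ⌊ i ≟ p ⌋
      row i with i ≟ p
      ... | yes _ = count-≟-allFin q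
      ... | no _ = sum-map-zero (allFin n)

  size-removeArc : ∀ (S : Rel n) p q → S p q ≡ true → size S ≡ suc (size (removeArc S p q))
  size-removeArc S p q Spq = begin
    size S
      ≡⟨ sumPairs-cong split ⟩
    sumPairs (λ i j → ind (arc p q i j) + ind (removeArc S p q i j))
      ≡⟨ sumPairs-+ _ _ ⟩
    size (arc p q) + size (removeArc S p q)
      ≡⟨ cong (_+ size (removeArc S p q)) (size-arc p q) ⟩
    suc (size (removeArc S p q))
      ∎
    where
      open ≡-Reasoning
      split : ∀ i j → ind (S i j) ≡ ind (arc p q i j) + ind (removeArc S p q i j)
      split i j with arc p q i j in i,j≡p,q | S i j in Sij
      ... | false | true = refl
      ... | false | false = refl
      ... | true | true = refl
      ... | true | false with arc-true {p} {q} {i} {j} i,j≡p,q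
      ...   | refl , refl = ⊥-elim (true≢false (trans (sym Spq) Sij))

  removeArc-⊆ : ∀ (S : Rel n) p q → removeArc S p q ⊆A S
  removeArc-⊆ S p q i j = ∧-conicalˡ (S i j) _

  reverseArc-⊆ : ∀ (R : Rel n) p q → reverseArc R p q ⊆A (arc q p ∪ R)
  reverseArc-⊆ R p q i j h with arc q p i j | arc p q i j
  ... | true | _ = refl
  ... | false | false = h

  minus-removeArc-⊆ : ∀ (D S : Rel n) p q → (D － removeArc S p q) ⊆A (arc p q ∪ (D － S))
  minus-removeArc-⊆ D S p q i j h with arc p q i j | S i j
  ... | true | _ = refl
  ... | false | true = h
  ... | false | false = h

  reverseArc-minus-removeArc-⊆ : ∀ (D S : Rel n) p q →
                                 (reverseArc D p q － removeArc S p q) ⊆A (arc q p ∪ (D － S))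
  reverseArc-minus-removeArc-⊆ D S p q i j h with arc q p i j | arc p q i j | S i j
  ... | true | _ | _ = refl
  ... | false | false | true = h
  ... | false | false | false = h

  removeArc-⊆-reverseArc : ∀ {S D : Rel n} {p q} → S ⊆A D → removeArc S p q ⊆A reverseArc D p q
  removeArc-⊆-reverseArc {S} {D} {p} {q} S⊆D i j h
    with arc q p i j | arc p q i j | S i j | S⊆D i j
  ... | true | _ | _ | _ = refl
  ... | false | false | true | Sij⇒Dij = Sij⇒Dij refl

  minus-⊆-reverseArc-minus : ∀ {D S : Rel n} {p q} → S p q ≡ true → D q p ≡ false →
                             (D － S) ⊆A (reverseArc D p q － removeArc S p q)
  minus-⊆-reverseArc-minus {D} {S} {p} {q} Spq Dqp i j h
    with arc q p i j in i,j≡q,p | arc p q i j in i,j≡p,q | D i j in Dij | S i j in Sij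
  ... | false | false | true | false = refl
  ... | true | _ | true | _ with arc-true {q} {p} {i} {j} i,j≡q,p
  ...   | refl , refl = ⊥-elim (true≢false (trans (sym Dij) Dqp))
  minus-⊆-reverseArc-minus {D} {S} {p} {q} Spq Dqp i j h
    | false | true | true | false with arc-true {p} {q} {i} {j} i,j≡p,q
  ...   | refl , refl = ⊥-elim (true≢false (trans (sym Spq) Sij))

  reverseArc-back-⊆ : ∀ {D R : Rel n} {p q} → D p q ≡ true → R ⊆A reverseArc D p q →
                      reverseArc R q p ⊆A D
  reverseArc-back-⊆ {D} {R} {p} {q} Dpq R⊆ i j h
    with arc p q i j in i,j≡p,q | arc q p i j | R i j | R⊆ i j
  ... | true | _ | _ | _ with arc-true {p} {q} {i} {j} i,j≡p,q
  ...   | refl , refl = Dpq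
  reverseArc-back-⊆ {D} {R} {p} {q} Dpq R⊆ i j h
    | false | false | true | Rij⇒Dij = Rij⇒Dij refl

  minus-reverseArc-back-⊆ : ∀ {D R : Rel n} {p q} → D q p ≡ false →
                            (D － reverseArc R q p) ⊆A (reverseArc D p q － R)
  minus-reverseArc-back-⊆ {D} {R} {p} {q} Dqp i j h
    with arc p q i j | arc q p i j in i,j≡q,p | R i j | D i j in Dij
  ... | false | false | false | true = refl
  ... | false | true | _ | true with arc-true {q} {p} {i} {j} i,j≡q,p
  ...   | refl , refl = ⊥-elim (true≢false (trans (sym Dij) Dqp))

  ⊆A-trans : ∀ {R R' R″ : Rel n} → R ⊆A R' → R' ⊆A R″ → R ⊆A R″
  ⊆A-trans R⊆R' R'⊆R″ i j h = R'⊆R″ i j (R⊆R' i j h)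

  size-reverseArc : ∀ (R : Rel n) p q → size (reverseArc R p q) ≤ suc (size R)
  size-reverseArc R p q = begin
    size (reverseArc R p q)  ≤⟨ size-mono (reverseArc-⊆ R p q) ⟩
    size (arc q p ∪ R)       ≤⟨ size-∪ (arc q p) R ⟩
    size (arc q p) + size R  ≡⟨ cong (_+ size R) (size-arc q p) ⟩
    suc (size R)             ∎
    where open ≤-Reasoning

  IsTournament-asym : ∀ {D : Rel n} {u v} → IsTournament D → D u v ≡ true → D v u ≡ false
  IsTournament-asym {D} {u} {v} (loopless , oneArc) Duv = trans (oneArc u v u≢v) (cong not Duv)
    where
      u≢v : u ≢ v
      u≢v refl = true≢false (trans (sym Duv) (loopless u))

module Reversal {n} (D : Rel n) (T : Subset n) {u v : Fin n} (Duv : D u v ≡ true) (Dvu : D v u ≡ false) where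

  v≢u : v ≢ u
  v≢u refl = true≢false (trans (sym Duv) Dvu)

  D′ : Rel n
  D′ = reverseArc D u v

  minTFAS-reverse : ∀ {S} → IsMinTFAS D T S → S u v ≡ true → IsMinTFAS D′ T (removeArc S u v)
  minTFAS-reverse {S} ((S⊆D , noCycle) , minimal) Suv =
    (removeArc-⊆-reverseArc S⊆D , noCycle′) , minimal′
    where
      S⁻ : Rel n
      S⁻ = removeArc S u v

      -- A T-cycle of D′ − S⁻ runs through vu; then D − S⁻ has none (it would run through uv),
      -- so S⁻ would be a smaller T-feedback arc set than S.
      noCycle′ : HasNoTCycle (D′ － S⁻) T
      noCycle′ c cs cycle = 1+n≰n (begin
        suc (size S⁻)  ≡⟨ sym (size-removeArc S u v Suv) ⟩
        size S         ≤⟨ minimal S⁻ (⊆A-trans (removeArc-⊆ S u v) S⊆D , noCycle⁻) ⟩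
        size S⁻        ∎)
        where
          open ≤-Reasoning
          noCycle⁻ : HasNoTCycle (D － S⁻) T
          noCycle⁻ = HasNoTCycle-antimono (minus-removeArc-⊆ D S u v)
            (tCycle-arc-exclusive v≢u noCycle
              (IsTCycle-mono (reverseArc-minus-removeArc-⊆ D S u v) cycle))

      minimal′ : ∀ R → IsTFAS D′ T R → size S⁻ ≤ size R
      minimal′ R (R⊆D′ , noCycleR) = ≤-pred (begin
        suc (size S⁻)            ≡⟨ sym (size-removeArc S u v Suv) ⟩
        size S                   ≤⟨ minimal (reverseArc R v u) tfas ⟩
        size (reverseArc R v u)  ≤⟨ size-reverseArc R v u ⟩
        suc (size R)             ∎)
        where
          open ≤-Reasoning
          tfas : IsTFAS D T (reverseArc R v u)
          tfas = reverseArc-back-⊆ Duv R⊆D′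
               , HasNoTCycle-antimono (minus-reverseArc-back-⊆ Dvu) noCycleR

  minTFAS-unreverse : ∀ {S S₀} → IsMinTFAS D T S₀ → S₀ u v ≡ true → S ⊆A D → S u v ≡ true →
                      IsMinTFAS D′ T (removeArc S u v) → IsMinTFAS D T S
  minTFAS-unreverse {S} {S₀} min₀ S₀uv S⊆D Suv ((_ , noCycle′) , minimal′) =
    (S⊆D , HasNoTCycle-antimono (minus-⊆-reverseArc-minus Suv Dvu) noCycle′) , minimal
    where
      minimal : ∀ R → IsTFAS D T R → size S ≤ size R
      minimal R tfas = begin
        size S                         ≡⟨ size-removeArc S u v Suv ⟩
        suc (size (removeArc S u v))   ≤⟨ s≤s (minimal′ _ (proj₁ (minTFAS-reverse min₀ S₀uv))) ⟩
        suc (size (removeArc S₀ u v))  ≡⟨ sym (size-removeArc S₀ u v S₀uv) ⟩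
        size S₀                        ≤⟨ proj₂ min₀ R tfas ⟩
        size R                         ∎
        where open ≤-Reasoning

proposition2 : (n : ℕ) (D : Rel n) → IsTournament D → (T : Subset n) →
    (u v : Fin n) → D u v ≡ true →
    (∃ λ S₀ → IsMinTFAS D T S₀ × S₀ u v ≡ true) →
    (S : Rel n) → S ⊆A D → S u v ≡ true →
    (IsMinTFAS D T S ⇔ IsMinTFAS (reverseArc D u v) T (removeArc S u v))
proposition2 n D tournament T u v Duv (S₀ , min₀ , S₀uv) S S⊆D Suv =
  mk⇔ (λ min → minTFAS-reverse min Suv) (minTFAS-unreverse min₀ S₀uv S⊆D Suv)
  where open Reversal D T Duv (IsTournament-asym tournament Duv)
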